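{- Consider the Static Black-Peg AB Game with $p=3$ pegs and $c\ge 5$ colors. Then: (a) For each feasible strategy and each peg, there is at most one color that does not occur on this peg. (b) A feasible strategy cannot contain two $(1,1,\star)$-questions which are disjoint in the first two pegs. (c) If a feasible strategy contains three $(1,1,\star)$-questions, then there is a permutation $\pi$ of the colors such that applying $\pi$ to every color maps these three questions to $(1\,|\,2\,|\,x_1)$, $(2\,|\,3\,|\,x_2)$, $(3\,|\,1\,|\,x_3)$ for suitable colors $x_1,x_2,x_3$. (d) If a feasible strategy contains three $(1,1,\star)$-questions, then on at least one of the first two pegs all $c$ colors occur. (e) A feasible strategy cannot contain four $(1,1,\star)$-questions. (f) Let a feasible strategy contain a $(1,1,\star)$-question $(q_1\,|\,q_2\,|\,x)$, let $q_3$ be a color not occurring on the first peg and $q_4$ a color not occurring on the second peg. Then $q_3\ne q_4$, and moreover $q_1=q_4$ or $q_2=q_3$. (g) Let a feasible strategy contain two $(1,1,\star)$-questions, let $q_1$ be a color not occurring on the first peg and $q_2$ a color not occurring on the second peg. Then there is a permutation $\pi$ of the colors with $\pi(q_1)=3$, $\pi(q_2)=1$ such that applying $\pi$ to every color maps the two questions (in some order) to $(1\,|\,2\,|\,x_1)$ and $(2\,|\,3\,|\,x_2)$ for suitable colors $x_1,x_2$. Moreover, the statements analogous to (b)–(g) obtained by replacing the pair of pegs $(1,2)$ by the pair $(1,3)$ (with $(1,\star,1)$-questions in place of $(1,1,\star)$-questions) or by the pair $(2,3)$ (with $(\star,1,1)$-questions) also hold.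
   Context: Static Black-Peg AB Game with $p$ pegs and $c\ge p$ colors $1,\dots,c$: secrets and questions are ordered $p$-tuples $(x_1\,|\,\dots\,|\,x_p)$ of pairwise distinct colors; the answer to question $Q$ for secret $S$ is the number of positions $i$ with $q_i=s_i$. A strategy is a list of pairwise distinct questions asked all at once; it is feasible if any two distinct secrets receive different vectors of answers. A color occurs on peg $i$ if it is the $i$-th entry of some question of the strategy. Questions $(q_1|q_2|q_3)$ and $(q'_1|q'_2|q'_3)$ are disjoint in the first two pegs if $\{q_1,q_2\}\cap\{q'_1,q'_2\}=\emptyset$. For a question $Q=(q_1|\dots|q_p)$ of a strategy, $Q$ is an $(a_1,\dots,a_p)$-question if for each $i$ the color $q_i$ occurs exactly $a_i$ times as the $i$-th entry among all questions of the strategy (including $Q$); an entry $\star$ in place of $a_i$ means no condition is imposed on peg $i$. -}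

module Defs where

open import Data.Nat using (ℕ; zero; suc; _≤_; s≤s; z≤n)
open import Data.Fin using (Fin; zero; suc; _<_) renaming (_≟_ to _≟ᶠ_)
open import Data.Vec using (Vec; lookup; tabulate)
import Data.Vec as V
open import Data.List using (List; []; _∷_; length; filter; map)
open import Data.List.Membership.Propositional using (_∈_)
open import Data.List.Relation.Unary.All using (All)
open import Data.List.Relation.Unary.Any using (Any)
open import Data.List.Relation.Unary.Unique.Propositional using (Unique)
open import Data.List.Relation.Binary.Permutation.Propositional using (_↭_)
open import Data.Fin.Permutation using (Permutation′; _⟨$⟩ʳ_)
open import Data.Product using (Σ; ∃; ∃-syntax; _×_; _,_)
open import Data.Sum using (_⊎_)
open import Relation.Binary.PropositionalEquality using (_≡_; _≢_)
open import Relation.Nullary using (¬_; does)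
open import Data.Bool using (if_then_else_)
open import Data.Nat.ListAction using (sum)
open import Data.Empty using (⊥)

-- Colors are Fin c; the paper's color k (1 ≤ k ≤ c) is the element k-1 of Fin c.
-- Pegs are Fin 3; the paper's peg i is the element i-1 of Fin 3.
-- A question / secret is a vector of 3 colors.
Code : ℕ → Set
Code c = Vec (Fin c) 3

Valid : ∀ {c} → Code c → Set
Valid q = ∀ (i j : Fin 3) → lookup q i ≡ lookup q j → i ≡ j

indicator : ∀ {c} → Fin c → Fin c → ℕ
indicator a b = if does (a ≟ᶠ b) then 1 else 0

answer : ∀ {c} → Code c → Code c → ℕ
answer q s = sum (map (λ i → indicator (lookup q i) (lookup s i)) (Data.List.allFin 3))

IsStrategy : ∀ {c} → List (Code c) → Set
IsStrategy S = All Valid S × Unique S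

Feasible : ∀ {c} → List (Code c) → Set
Feasible S = ∀ s s' → Valid s → Valid s' →
  map (λ q → answer q s) S ≡ map (λ q → answer q s') S → s ≡ s'

Occurs : ∀ {c} → List (Code c) → Fin 3 → Fin c → Set
Occurs S i k = Any (λ q → lookup q i ≡ k) S

occ : ∀ {c} → List (Code c) → Fin 3 → Fin c → ℕ
occ S i k = length (filter (λ q → lookup q i ≟ᶠ k) S)

-- Q ∈ S is a question whose colors on pegs i and j each occur exactly once
-- on that peg (a (1,1,⋆)-question for (i,j) = (peg1,peg2), etc.)
OneOne : ∀ {c} → List (Code c) → Fin 3 → Fin 3 → Code c → Set
OneOne S i j Q = Q ∈ S × occ S i (lookup Q i) ≡ 1 × occ S j (lookup Q j) ≡ 1

DisjointOn : ∀ {c} → Fin 3 → Fin 3 → Code c → Code c → Set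
DisjointOn i j Q Q' =
  lookup Q i ≢ lookup Q' i × lookup Q i ≢ lookup Q' j ×
  lookup Q j ≢ lookup Q' i × lookup Q j ≢ lookup Q' j

tri : ∀ {c} → Fin 3 → Fin 3 → Fin c → Fin c → Fin c → Code c
tri i j a b x = tabulate (λ l → if does (l ≟ᶠ i) then a else (if does (l ≟ᶠ j) then b else x))

applyπ : ∀ {c} → Permutation′ c → Code c → Code c
applyπ π q = V.map (π ⟨$⟩ʳ_) q

col1 col2 col3 : ∀ {c} → 5 ≤ c → Fin c
col1 (s≤s _) = zero
col2 (s≤s (s≤s _)) = suc zero
col3 (s≤s (s≤s (s≤s _))) = suc (suc zero)

module _ {c : ℕ} (h : 5 ≤ c) (S : List (Code c)) where

  PartA : Set
  PartA = ∀ (i : Fin 3) (k k' : Fin c) → ¬ Occurs S i k → ¬ Occurs S i k' → k ≡ k'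

  module _ (i j : Fin 3) where
    PartB : Set
    PartB = ∀ Q Q' → OneOne S i j Q → OneOne S i j Q' → Q ≢ Q' → ¬ DisjointOn i j Q Q'

    PartC : Set
    PartC = ∀ Q₁ Q₂ Q₃ → OneOne S i j Q₁ → OneOne S i j Q₂ → OneOne S i j Q₃ →
      Q₁ ≢ Q₂ → Q₁ ≢ Q₃ → Q₂ ≢ Q₃ →
      Σ (Permutation′ c) λ π → ∃[ x₁ ] ∃[ x₂ ] ∃[ x₃ ]
        (applyπ π Q₁ ∷ applyπ π Q₂ ∷ applyπ π Q₃ ∷ [])
          ↭ (tri i j (col1 h) (col2 h) x₁ ∷ tri i j (col2 h) (col3 h) x₂ ∷ tri i j (col3 h) (col1 h) x₃ ∷ [])

    PartD : Set
    PartD = ∀ Q₁ Q₂ Q₃ → OneOne S i j Q₁ → OneOne S i j Q₂ → OneOne S i j Q₃ →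
      Q₁ ≢ Q₂ → Q₁ ≢ Q₃ → Q₂ ≢ Q₃ →
      (∀ k → Occurs S i k) ⊎ (∀ k → Occurs S j k)

    PartE : Set
    PartE = ∀ Q₁ Q₂ Q₃ Q₄ → OneOne S i j Q₁ → OneOne S i j Q₂ → OneOne S i j Q₃ → OneOne S i j Q₄ →
      Q₁ ≢ Q₂ → Q₁ ≢ Q₃ → Q₁ ≢ Q₄ → Q₂ ≢ Q₃ → Q₂ ≢ Q₄ → Q₃ ≢ Q₄ → ⊥

    PartF : Set
    PartF = ∀ Q q₃ q₄ → OneOne S i j Q → ¬ Occurs S i q₃ → ¬ Occurs S j q₄ →
      q₃ ≢ q₄ × (lookup Q i ≡ q₄ ⊎ lookup Q j ≡ q₃)

    PartG : Set
    PartG = ∀ Q₁ Q₂ q₁ q₂ → OneOne S i j Q₁ → OneOne S i j Q₂ → Q₁ ≢ Q₂ →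
      ¬ Occurs S i q₁ → ¬ Occurs S j q₂ →
      Σ (Permutation′ c) λ π → (π ⟨$⟩ʳ q₁ ≡ col3 h) × (π ⟨$⟩ʳ q₂ ≡ col1 h) × ∃[ x₁ ] ∃[ x₂ ]
        ((applyπ π Q₁ ≡ tri i j (col1 h) (col2 h) x₁ × applyπ π Q₂ ≡ tri i j (col2 h) (col3 h) x₂)
        ⊎ (applyπ π Q₂ ≡ tri i j (col1 h) (col2 h) x₁ × applyπ π Q₁ ≡ tri i j (col2 h) (col3 h) x₂))

    PartsBG : Set
    PartsBG = PartB × PartC × PartD × PartE × PartF × PartG

-- Every step compares two secrets that a feasible strategy must tell apart.
-- Let Q = (a|b|·) be a (1,1,⋆)-question and α, β colours such that every
-- other question has α on the first peg exactly when it has β on the second.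
-- Then the secrets (a|β|y) and (α|b|y), with y a fifth colour, get the same
-- answers, which is impossible. Taking for α, β colours missing from the
-- pegs gives (f), taking the colours of a second (1,1,⋆)-question gives (b);
-- (a) is the simpler fact that two secrets differing only in a colour that is
-- missing from that peg get the same answers. By (b) any two (1,1,⋆)-questions
-- are linked (the first colour of one is the second colour of the other), so
-- three of them form a cycle (c), a fourth cannot be linked to that cycle (e),
-- and (d), (g) combine the links with (f).
module Submission where

open import Defs
open import Data.Nat using (ℕ; _≤_; _+_)
import Data.Nat as ℕ
import Data.Nat.Properties as ℕ
open import Algebra.Properties.CommutativeSemigroup ℕ.+-commutativeSemigroup
  using (x∙yz≈xz∙y; x∙yz≈yz∙x)
open import Data.Fin using (Fin; zero; suc; _<_) renaming (_≟_ to _≟ᶠ_)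
import Data.Fin.Properties as Fin
open import Data.Fin.Permutation using (Permutation′; _⟨$⟩ʳ_; _⟨$⟩ˡ_; inverseˡ; transpose; _∘ₚ_)
  renaming (id to idₚ)
import Data.Fin.Permutation.Components as PC
open import Data.Vec using (_∷_; []; lookup)
import Data.Vec.Properties as Vec
open import Data.List using (List; []; _∷_)
open import Data.List.Properties using (map-cong-local)
open import Data.List.Membership.Propositional using (_∈_)
open import Data.List.Relation.Unary.Any using (here; there)
import Data.List.Relation.Unary.Any as Any
import Data.List.Relation.Unary.All as All
open import Data.List.Relation.Binary.Permutation.Propositional using (prep; swap; ↭-reflexive; ↭-trans; ↭-refl)
open import Data.Product using (Σ; ∃-syntax; _×_; _,_; proj₁; proj₂)
open import Data.Sum using (_⊎_; inj₁; inj₂)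
open import Data.Empty using (⊥; ⊥-elim)
open import Function using (_∘_)
open import Function.Definitions using (Injective)
open import Relation.Nullary using (¬_; Dec; yes; no; contradiction)
open import Relation.Nullary.Decidable using (¬?; decidable-stable)
open import Relation.Binary.PropositionalEquality using (_≡_; _≢_; refl; sym; trans; cong; cong₂; subst; ≢-sym)

hit : ∀ {c} → Code c → Fin 3 → Fin c → ℕ
hit q p a = indicator (lookup q p) a

hit-self : ∀ {c} (q : Code c) p → hit q p (lookup q p) ≡ 1
hit-self q p with lookup q p ≟ᶠ lookup q p
... | yes _ = refl
... | no ≢self = contradiction refl ≢self

hit-≢ : ∀ {c} (q : Code c) p {a} → lookup q p ≢ a → hit q p a ≡ 0
hit-≢ q p {a} ≢a with lookup q p ≟ᶠ a
... | yes ≡a = contradiction ≡a ≢a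
... | no _ = refl

answer-∷ : ∀ {c} (q : Code c) (a b x : Fin c) →
  answer q (a ∷ b ∷ x ∷ []) ≡ hit q zero a + (hit q (suc zero) b + hit q (suc (suc zero)) x)
answer-∷ q a b x = cong (λ t → hit q zero a + (hit q (suc zero) b + t)) (ℕ.+-identityʳ (hit q (suc (suc zero)) x))

distinct⇒valid : ∀ {c} {a b x : Fin c} → a ≢ b → a ≢ x → b ≢ x → Valid (a ∷ b ∷ x ∷ [])
distinct⇒valid a≢b a≢x b≢x zero             zero             _ = refl
distinct⇒valid a≢b a≢x b≢x zero             (suc zero)       e = contradiction e a≢b
distinct⇒valid a≢b a≢x b≢x zero             (suc (suc zero)) e = contradiction e a≢x
distinct⇒valid a≢b a≢x b≢x (suc zero)       zero             e = contradiction (sym e) a≢b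
distinct⇒valid a≢b a≢x b≢x (suc zero)       (suc zero)       _ = refl
distinct⇒valid a≢b a≢x b≢x (suc zero)       (suc (suc zero)) e = contradiction e b≢x
distinct⇒valid a≢b a≢x b≢x (suc (suc zero)) zero             e = contradiction (sym e) a≢x
distinct⇒valid a≢b a≢x b≢x (suc (suc zero)) (suc zero)       e = contradiction (sym e) b≢x
distinct⇒valid a≢b a≢x b≢x (suc (suc zero)) (suc (suc zero)) _ = refl

avoid : ∀ {m n} → m ℕ.< n → (xs : Fin m → Fin n) → ∃[ y ] (∀ t → y ≢ xs t)
avoid {m} m<n xs with Fin.any? (λ y → Fin.all? (λ t → ¬? (y ≟ᶠ xs t)))
... | yes avoiding = avoiding
... | no none = contradiction (Fin.injective⇒≤ preimage-injective) (ℕ.<⇒≱ m<n)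
  where
    preimage : ∀ y → ∃[ t ] y ≡ xs t
    preimage y with Fin.¬∀⟶∃¬ m _ (λ t → ¬? (y ≟ᶠ xs t)) (λ all → none (y , all))
    ... | t , ¬y≢xs = t , decidable-stable (y ≟ᶠ xs t) ¬y≢xs
    preimage-injective : Injective _≡_ _≡_ (proj₁ ∘ preimage)
    preimage-injective {y} {y′} e =
      trans (proj₂ (preimage y)) (trans (cong xs e) (sym (proj₂ (preimage y′))))

avoid-four : ∀ {c} → 5 ≤ c → (x₁ x₂ x₃ x₄ : Fin c) → ∃[ y ] (y ≢ x₁ × y ≢ x₂ × y ≢ x₃ × y ≢ x₄)
avoid-four 5≤c x₁ x₂ x₃ x₄ with avoid 5≤c (lookup (x₁ ∷ x₂ ∷ x₃ ∷ x₄ ∷ []))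
... | y , y≢ = y , y≢ zero , y≢ (suc zero) , y≢ (suc (suc zero)) , y≢ (suc (suc (suc zero)))

col-distinct : ∀ {c} (h : 5 ≤ c) → col1 h ≢ col2 h × col1 h ≢ col3 h × col2 h ≢ col3 h
col-distinct (ℕ.s≤s (ℕ.s≤s (ℕ.s≤s _))) = (λ ()) , (λ ()) , (λ ())

module _ {n : ℕ} where

  transpose-matchˡ : (a b : Fin n) → PC.transpose a b a ≡ b
  transpose-matchˡ a b with a ≟ᶠ a
  ... | yes _ = refl
  ... | no a≢a = contradiction refl a≢a

  transpose-mismatch : {a b x : Fin n} → x ≢ a → x ≢ b → PC.transpose a b x ≡ x
  transpose-mismatch {a} {b} {x} x≢a x≢b with x ≟ᶠ a
  ... | yes x≡a = contradiction x≡a x≢a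
  ... | no _ with x ≟ᶠ b
  ...   | yes x≡b = contradiction x≡b x≢b
  ...   | no _ = refl

  ⟨$⟩ʳ-injective : (π : Permutation′ n) → Injective _≡_ _≡_ (π ⟨$⟩ʳ_)
  ⟨$⟩ʳ-injective π e = trans (sym (inverseˡ π)) (trans (cong (π ⟨$⟩ˡ_) e) (inverseˡ π))

  redirect : (π : Permutation′ n) (x t : Fin n) →
    Σ (Permutation′ n) λ ρ → ρ ⟨$⟩ʳ x ≡ t × (∀ {y} → y ≢ x → π ⟨$⟩ʳ y ≢ t → ρ ⟨$⟩ʳ y ≡ π ⟨$⟩ʳ y)
  redirect π x t = π ∘ₚ transpose (π ⟨$⟩ʳ x) t
                 , transpose-matchˡ (π ⟨$⟩ʳ x) t
                 , λ y≢x πy≢t → transpose-mismatch (y≢x ∘ ⟨$⟩ʳ-injective π) πy≢t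

  send-three : {u v w a b d : Fin n} → u ≢ v → u ≢ w → v ≢ w → a ≢ b → a ≢ d → b ≢ d →
    Σ (Permutation′ n) λ π → π ⟨$⟩ʳ u ≡ a × π ⟨$⟩ʳ v ≡ b × π ⟨$⟩ʳ w ≡ d
  send-three {u} {v} {w} {a} {b} {d} u≢v u≢w v≢w a≢b a≢d b≢d with redirect idₚ u a
  ... | π₁ , π₁u , _ with redirect π₁ v b
  ... | π₂ , π₂v , fix₂ with redirect π₂ w d
  ... | π₃ , π₃w , fix₃ =
    let π₂u = trans (fix₂ u≢v (subst (_≢ b) (sym π₁u) a≢b)) π₁u
    in π₃ , trans (fix₃ u≢w (subst (_≢ d) (sym π₂u) a≢d)) π₂u
          , trans (fix₃ v≢w (subst (_≢ d) (sym π₂v) b≢d)) π₂v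
          , π₃w

occ-positive : ∀ {c} (S : List (Code c)) p {k q} → q ∈ S → lookup q p ≡ k → occ S p k ≢ 0
occ-positive (y ∷ ys) p {k} (here refl) e with lookup y p ≟ᶠ k
... | yes _ = λ ()
... | no ne = contradiction e ne
occ-positive (y ∷ ys) p {k} (there q∈ys) e with lookup y p ≟ᶠ k
... | yes _ = λ ()
... | no _ = occ-positive ys p q∈ys e

occ≡1⇒unique : ∀ {c} (S : List (Code c)) p {k q q′} → occ S p k ≡ 1 →
  q ∈ S → q′ ∈ S → lookup q p ≡ k → lookup q′ p ≡ k → q ≡ q′
occ≡1⇒unique (y ∷ ys) p o (here refl) (here refl) _ _ = refl
occ≡1⇒unique (y ∷ ys) p {k} o (here refl) (there q′∈ys) e e′ with lookup y p ≟ᶠ k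
... | yes _ = contradiction (ℕ.suc-injective o) (occ-positive ys p q′∈ys e′)
... | no ne = contradiction e ne
occ≡1⇒unique (y ∷ ys) p {k} o (there q∈ys) (here refl) e e′ with lookup y p ≟ᶠ k
... | yes _ = contradiction (ℕ.suc-injective o) (occ-positive ys p q∈ys e)
... | no ne = contradiction e′ ne
occ≡1⇒unique (y ∷ ys) p {k} o (there q∈ys) (there q′∈ys) e e′ with lookup y p ≟ᶠ k
... | yes _ = contradiction (ℕ.suc-injective o) (occ-positive ys p q∈ys e)
... | no _ = occ≡1⇒unique ys p o q∈ys q′∈ys e e′

record PegSplit (i j : Fin 3) : Set where
  field
    third : Fin 3
    i≢j : i ≢ j
    answer-tri : ∀ {c} (q : Code c) (a b x : Fin c) → answer q (tri i j a b x)
      ≡ hit q i a + hit q j b + hit q third x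
    tri-valid : ∀ {c} {a b x : Fin c} → a ≢ b → a ≢ x → b ≢ x → Valid (tri i j a b x)
    tri-η : ∀ {c} (q : Code c) → q ≡ tri i j (lookup q i) (lookup q j) (lookup q third)
    lookup-tri-i : ∀ {c} (a b x : Fin c) → lookup (tri i j a b x) i ≡ a
    lookup-tri-j : ∀ {c} (a b x : Fin c) → lookup (tri i j a b x) j ≡ b
    applyπ-tri : ∀ {c} π (a b x : Fin c) → applyπ π (tri i j a b x) ≡ tri i j (π ⟨$⟩ʳ a) (π ⟨$⟩ʳ b) (π ⟨$⟩ʳ x)

pegs01 : PegSplit zero (suc zero)
pegs01 = record
  { third = suc (suc zero)
  ; i≢j = λ ()
  ; answer-tri = λ q a b x → trans (answer-∷ q a b x) (sym (ℕ.+-assoc (hit q zero a) _ _))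
  ; tri-valid = distinct⇒valid
  ; tri-η = λ { (_ ∷ _ ∷ _ ∷ []) → refl }
  ; lookup-tri-i = λ _ _ _ → refl
  ; lookup-tri-j = λ _ _ _ → refl
  ; applyπ-tri = λ _ _ _ _ → refl
  }

pegs02 : PegSplit zero (suc (suc zero))
pegs02 = record
  { third = suc zero
  ; i≢j = λ ()
  ; answer-tri = λ q a b x → trans (answer-∷ q a x b) (x∙yz≈xz∙y (hit q zero a) (hit q (suc zero) x) (hit q (suc (suc zero)) b))
  ; tri-valid = λ a≢b a≢x b≢x → distinct⇒valid a≢x a≢b (≢-sym b≢x)
  ; tri-η = λ { (_ ∷ _ ∷ _ ∷ []) → refl }
  ; lookup-tri-i = λ _ _ _ → refl
  ; lookup-tri-j = λ _ _ _ → refl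
  ; applyπ-tri = λ _ _ _ _ → refl
  }

pegs12 : PegSplit (suc zero) (suc (suc zero))
pegs12 = record
  { third = zero
  ; i≢j = λ ()
  ; answer-tri = λ q a b x → trans (answer-∷ q x a b) (x∙yz≈yz∙x (hit q zero x) (hit q (suc zero) a) (hit q (suc (suc zero)) b))
  ; tri-valid = λ a≢b a≢x b≢x → distinct⇒valid (≢-sym a≢x) (≢-sym b≢x) a≢b
  ; tri-η = λ { (_ ∷ _ ∷ _ ∷ []) → refl }
  ; lookup-tri-i = λ _ _ _ → refl
  ; lookup-tri-j = λ _ _ _ → refl
  ; applyπ-tri = λ _ _ _ _ → refl
  }

pegSplit : ∀ {i j : Fin 3} → i < j → PegSplit i j
pegSplit {zero} {suc zero} _ = pegs01
pegSplit {zero} {suc (suc zero)} _ = pegs02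
pegSplit {suc zero} {suc (suc zero)} _ = pegs12
pegSplit {suc zero} {suc zero} (ℕ.s≤s ())
pegSplit {suc (suc zero)} {suc zero} (ℕ.s≤s ())
pegSplit {suc (suc zero)} {suc (suc zero)} (ℕ.s≤s (ℕ.s≤s ()))

module Pegs {c : ℕ} (h : 5 ≤ c) (S : List (Code c)) (st : IsStrategy S) (fe : Feasible S)
            {i j : Fin 3} (P : PegSplit i j) where
  open PegSplit P

  c₁ c₂ c₃ : Fin c
  c₁ = col1 h
  c₂ = col2 h
  c₃ = col3 h

  ∈⇒≢ : ∀ {q} → q ∈ S → lookup q i ≢ lookup q j
  ∈⇒≢ q∈S = i≢j ∘ All.lookup (proj₁ st) q∈S i j

  missing⇒≢ : ∀ {p z q} → ¬ Occurs S p z → q ∈ S → lookup q p ≢ z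
  missing⇒≢ z∉ q∈S e = z∉ (Any.map (λ { refl → e }) q∈S)

  missing⇒no-hit : ∀ {p z q} → ¬ Occurs S p z → q ∈ S → hit q p z ≡ 0
  missing⇒no-hit {p} {q = q} z∉ q∈S = hit-≢ q p (missing⇒≢ z∉ q∈S)

  uniqueᵢ : ∀ {Q q} → OneOne S i j Q → q ∈ S → lookup q i ≡ lookup Q i → q ≡ Q
  uniqueᵢ (Q∈S , oᵢ , _) q∈S e = occ≡1⇒unique S i oᵢ q∈S Q∈S e refl

  uniqueⱼ : ∀ {Q q} → OneOne S i j Q → q ∈ S → lookup q j ≡ lookup Q j → q ≡ Q
  uniqueⱼ (Q∈S , _ , oⱼ) q∈S e = occ≡1⇒unique S j oⱼ q∈S Q∈S e refl

  ≡ᵢ⇒≡ : ∀ {Q Q′} → OneOne S i j Q → OneOne S i j Q′ → lookup Q i ≡ lookup Q′ i → Q ≡ Q′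
  ≡ᵢ⇒≡ o o′ = uniqueᵢ o′ (proj₁ o)

  ≡ⱼ⇒≡ : ∀ {Q Q′} → OneOne S i j Q → OneOne S i j Q′ → lookup Q j ≡ lookup Q′ j → Q ≡ Q′
  ≡ⱼ⇒≡ o o′ = uniqueⱼ o′ (proj₁ o)

  ≢ᵢ : ∀ {Q Q′} → OneOne S i j Q → OneOne S i j Q′ → Q ≢ Q′ → lookup Q i ≢ lookup Q′ i
  ≢ᵢ o o′ Q≢Q′ = Q≢Q′ ∘ ≡ᵢ⇒≡ o o′

  ≢ⱼ : ∀ {Q Q′} → OneOne S i j Q → OneOne S i j Q′ → Q ≢ Q′ → lookup Q j ≢ lookup Q′ j
  ≢ⱼ o o′ Q≢Q′ = Q≢Q′ ∘ ≡ⱼ⇒≡ o o′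

  hits : Code c → Fin c → Fin c → Fin c → ℕ
  hits q a b x = hit q i a + hit q j b + hit q third x

  indistinguishable : ∀ {a b x a′ b′ x′} → a ≢ b → a ≢ x → b ≢ x → a′ ≢ b′ → a′ ≢ x′ → b′ ≢ x′ →
    (∀ {q} → q ∈ S → hits q a b x ≡ hits q a′ b′ x′) → tri i j a b x ≡ tri i j a′ b′ x′
  indistinguishable a≢b a≢x b≢x a′≢b′ a′≢x′ b′≢x′ same =
    fe _ _ (tri-valid a≢b a≢x b≢x) (tri-valid a′≢b′ a′≢x′ b′≢x′)
       (map-cong-local (All.tabulate λ {q} q∈S →
          trans (answer-tri q _ _ _) (trans (same q∈S) (sym (answer-tri q _ _ _)))))

  tri-injectiveᵢ : ∀ {a b x a′ b′ x′ : Fin c} → tri i j a b x ≡ tri i j a′ b′ x′ → a ≡ a′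
  tri-injectiveᵢ e = trans (sym (lookup-tri-i _ _ _)) (trans (cong (λ s → lookup s i) e) (lookup-tri-i _ _ _))

  tri-injectiveⱼ : ∀ {a b x a′ b′ x′ : Fin c} → tri i j a b x ≡ tri i j a′ b′ x′ → b ≡ b′
  tri-injectiveⱼ e = trans (sym (lookup-tri-j _ _ _)) (trans (cong (λ s → lookup s j) e) (lookup-tri-j _ _ _))

  missing-uniqueᵢ : ∀ {z z′} → ¬ Occurs S i z → ¬ Occurs S i z′ → z ≡ z′
  missing-uniqueᵢ {z} {z′} z∉ z′∉ with avoid-four h z z′ z z′
  ... | u , u≢z , u≢z′ , _ with avoid-four h z z′ u u
  ...   | v , v≢z , v≢z′ , v≢u , _ =
    tri-injectiveᵢ (indistinguishable (≢-sym u≢z) (≢-sym v≢z) (≢-sym v≢u) (≢-sym u≢z′) (≢-sym v≢z′) (≢-sym v≢u)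
      λ {q} q∈S → cong (λ t → t + hit q j u + hit q third v)
                       (trans (missing⇒no-hit z∉ q∈S) (sym (missing⇒no-hit z′∉ q∈S))))

  missing-uniqueⱼ : ∀ {z z′} → ¬ Occurs S j z → ¬ Occurs S j z′ → z ≡ z′
  missing-uniqueⱼ {z} {z′} z∉ z′∉ with avoid-four h z z′ z z′
  ... | u , u≢z , u≢z′ , _ with avoid-four h z z′ u u
  ...   | v , v≢z , v≢z′ , v≢u , _ =
    tri-injectiveⱼ (indistinguishable u≢z (≢-sym v≢u) (≢-sym v≢z) u≢z′ (≢-sym v≢u) (≢-sym v≢z′)
      λ {q} q∈S → cong (λ t → hit q i u + t + hit q third v)
                       (trans (missing⇒no-hit z∉ q∈S) (sym (missing⇒no-hit z′∉ q∈S))))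

  unswappable : ∀ {Q α β} → OneOne S i j Q → lookup Q i ≢ β → α ≢ lookup Q j →
    β ≢ lookup Q j → α ≢ lookup Q i →
    (∀ {q} → q ∈ S → q ≢ Q → hit q j β ≡ hit q i α) → ⊥
  unswappable {Q} {α} {β} o a≢β α≢b β≢b α≢a same with avoid-four h (lookup Q i) (lookup Q j) α β
  ... | y , y≢a , y≢b , y≢α , y≢β =
    α≢a (sym (tri-injectiveᵢ
      (indistinguishable a≢β (≢-sym y≢a) (≢-sym y≢β) α≢b (≢-sym y≢α) (≢-sym y≢b) same-hits)))
    where
      same-hits : ∀ {q} → q ∈ S → hits q (lookup Q i) β y ≡ hits q α (lookup Q j) y
      same-hits {q} q∈S with Vec.≡-dec _≟ᶠ_ q Q
      ... | yes refl = cong (_+ hit Q third y)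
        (trans (cong₂ _+_ (hit-self Q i) (hit-≢ Q j (≢-sym β≢b))) (sym (cong₂ _+_ (hit-≢ Q i (≢-sym α≢a)) (hit-self Q j))))
      ... | no q≢Q = cong (_+ hit q third y)
        (trans (cong₂ _+_ (hit-≢ q i (q≢Q ∘ uniqueᵢ o q∈S)) (same q∈S q≢Q))
               (sym (trans (cong (hit q i α +_) (hit-≢ q j (q≢Q ∘ uniqueⱼ o q∈S))) (ℕ.+-identityʳ (hit q i α)))))

  partB : PartB h S i j
  partB Q Q′ o o′ Q≢Q′ (Qi≢Q′i , Qi≢Q′j , Qj≢Q′i , Qj≢Q′j) =
    unswappable o Qi≢Q′j (≢-sym Qj≢Q′i) (≢-sym Qj≢Q′j) (≢-sym Qi≢Q′i) same
    where
      same : ∀ {q} → q ∈ S → q ≢ Q → hit q j (lookup Q′ j) ≡ hit q i (lookup Q′ i)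
      same {q} q∈S _ with Vec.≡-dec _≟ᶠ_ q Q′
      ... | yes refl = trans (hit-self q j) (sym (hit-self q i))
      ... | no q≢Q′ = trans (hit-≢ q j (q≢Q′ ∘ uniqueⱼ o′ q∈S)) (sym (hit-≢ q i (q≢Q′ ∘ uniqueᵢ o′ q∈S)))

  ¬unpinned : ∀ {Q α β} → OneOne S i j Q → ¬ Occurs S i α → ¬ Occurs S j β →
    lookup Q i ≢ β → α ≢ lookup Q j → ⊥
  ¬unpinned o@(Q∈S , _) α∉ β∉ a≢β α≢b =
    unswappable o a≢β α≢b (≢-sym (missing⇒≢ β∉ Q∈S)) (≢-sym (missing⇒≢ α∉ Q∈S))
      λ q∈S _ → trans (missing⇒no-hit β∉ q∈S) (sym (missing⇒no-hit α∉ q∈S))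

  missing-distinct : ∀ {Q q₃ q₄} → OneOne S i j Q → ¬ Occurs S i q₃ → ¬ Occurs S j q₄ → q₃ ≢ q₄
  missing-distinct o@(Q∈S , _) q₃∉ q₄∉ refl =
    ¬unpinned o q₃∉ q₄∉ (missing⇒≢ q₃∉ Q∈S) (≢-sym (missing⇒≢ q₄∉ Q∈S))

  pinned : ∀ {Q q₃ q₄} → OneOne S i j Q → ¬ Occurs S i q₃ → ¬ Occurs S j q₄ →
    lookup Q i ≡ q₄ ⊎ lookup Q j ≡ q₃
  pinned {Q} {q₃} {q₄} o q₃∉ q₄∉ with lookup Q i ≟ᶠ q₄ | lookup Q j ≟ᶠ q₃
  ... | yes e | _ = inj₁ e
  ... | no _ | yes e = inj₂ e
  ... | no Qi≢q₄ | no Qj≢q₃ = ⊥-elim (¬unpinned o q₃∉ q₄∉ Qi≢q₄ (≢-sym Qj≢q₃))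

  partF : PartF h S i j
  partF _ _ _ o q₃∉ q₄∉ = missing-distinct o q₃∉ q₄∉ , pinned o q₃∉ q₄∉

  pinned-apart : ∀ {Q Q′ q₃ q₄} → OneOne S i j Q → OneOne S i j Q′ → Q ≢ Q′ →
    lookup Q i ≡ q₄ ⊎ lookup Q j ≡ q₃ → lookup Q′ i ≡ q₄ ⊎ lookup Q′ j ≡ q₃ →
    (lookup Q i ≡ q₄ × lookup Q′ j ≡ q₃) ⊎ (lookup Q j ≡ q₃ × lookup Q′ i ≡ q₄)
  pinned-apart o o′ Q≢Q′ (inj₁ e) (inj₁ e′) = contradiction (≡ᵢ⇒≡ o o′ (trans e (sym e′))) Q≢Q′
  pinned-apart o o′ Q≢Q′ (inj₂ e) (inj₂ e′) = contradiction (≡ⱼ⇒≡ o o′ (trans e (sym e′))) Q≢Q′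
  pinned-apart o o′ Q≢Q′ (inj₁ e) (inj₂ e′) = inj₁ (e , e′)
  pinned-apart o o′ Q≢Q′ (inj₂ e) (inj₁ e′) = inj₂ (e , e′)

  occurs? : ∀ p z → Dec (Occurs S p z)
  occurs? p z = Any.any? (λ q → lookup q p ≟ᶠ z) S

  partD : PartD h S i j
  partD Q₁ Q₂ Q₃ o₁ o₂ o₃ Q₁≢Q₂ Q₁≢Q₃ Q₂≢Q₃ with Fin.all? (occurs? i) | Fin.all? (occurs? j)
  ... | yes all | _ = inj₁ all
  ... | no _ | yes all = inj₂ all
  ... | no ¬allᵢ | no ¬allⱼ
    with Fin.¬∀⟶∃¬ c _ (occurs? i) ¬allᵢ | Fin.¬∀⟶∃¬ c _ (occurs? j) ¬allⱼ
  ... | q₃ , q₃∉ | q₄ , q₄∉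
    with pinned-apart o₁ o₂ Q₁≢Q₂ (pinned o₁ q₃∉ q₄∉) (pinned o₂ q₃∉ q₄∉)
       | pinned-apart o₁ o₃ Q₁≢Q₃ (pinned o₁ q₃∉ q₄∉) (pinned o₃ q₃∉ q₄∉)
  ... | inj₁ (_ , e₂) | inj₁ (_ , e₃) = ⊥-elim (Q₂≢Q₃ (≡ⱼ⇒≡ o₂ o₃ (trans e₂ (sym e₃))))
  ... | inj₂ (_ , e₂) | inj₂ (_ , e₃) = ⊥-elim (Q₂≢Q₃ (≡ᵢ⇒≡ o₂ o₃ (trans e₂ (sym e₃))))
  ... | inj₁ (e₁ , _) | inj₂ (_ , e₃) = ⊥-elim (Q₁≢Q₃ (≡ᵢ⇒≡ o₁ o₃ (trans e₁ (sym e₃))))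
  ... | inj₂ (e₁ , _) | inj₁ (_ , e₃) = ⊥-elim (Q₁≢Q₃ (≡ⱼ⇒≡ o₁ o₃ (trans e₁ (sym e₃))))

  linked : ∀ {Q Q′} → OneOne S i j Q → OneOne S i j Q′ → Q ≢ Q′ →
    lookup Q i ≡ lookup Q′ j ⊎ lookup Q j ≡ lookup Q′ i
  linked {Q} {Q′} o o′ Q≢Q′ with lookup Q i ≟ᶠ lookup Q′ j | lookup Q j ≟ᶠ lookup Q′ i
  ... | yes e | _ = inj₁ e
  ... | no _ | yes e = inj₂ e
  ... | no Qi≢Q′j | no Qj≢Q′i =
    ⊥-elim (partB Q Q′ o o′ Q≢Q′ (≢ᵢ o o′ Q≢Q′ , Qi≢Q′j , Qj≢Q′i , ≢ⱼ o o′ Q≢Q′))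

  Cyclic : Code c → Code c → Code c → Set
  Cyclic Q₁ Q₂ Q₃ = lookup Q₁ j ≡ lookup Q₂ i × lookup Q₂ j ≡ lookup Q₃ i × lookup Q₃ j ≡ lookup Q₁ i

  cyclic : ∀ {Q₁ Q₂ Q₃} → OneOne S i j Q₁ → OneOne S i j Q₂ → OneOne S i j Q₃ →
    Q₁ ≢ Q₂ → Q₁ ≢ Q₃ → Q₂ ≢ Q₃ → Cyclic Q₁ Q₂ Q₃ ⊎ Cyclic Q₁ Q₃ Q₂
  cyclic o₁ o₂ o₃ Q₁≢Q₂ Q₁≢Q₃ Q₂≢Q₃
    with linked o₁ o₂ Q₁≢Q₂ | linked o₂ o₃ Q₂≢Q₃ | linked o₃ o₁ (≢-sym Q₁≢Q₃)
  ... | inj₂ e₁₂ | inj₂ e₂₃ | inj₂ e₃₁ = inj₁ (e₁₂ , e₂₃ , e₃₁)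
  ... | inj₁ e₁₂ | inj₁ e₂₃ | inj₁ e₃₁ = inj₂ (sym e₃₁ , sym e₂₃ , sym e₁₂)
  ... | inj₂ e₁₂ | inj₁ e₂₃ | _ = ⊥-elim (Q₁≢Q₃ (≡ⱼ⇒≡ o₁ o₃ (trans e₁₂ e₂₃)))
  ... | inj₁ e₁₂ | inj₂ e₂₃ | _ = ⊥-elim (Q₁≢Q₃ (≡ᵢ⇒≡ o₁ o₃ (trans e₁₂ e₂₃)))
  ... | inj₂ e₁₂ | inj₂ _ | inj₁ e₃₁ = ⊥-elim (Q₂≢Q₃ (sym (≡ᵢ⇒≡ o₃ o₂ (trans e₃₁ e₁₂))))
  ... | inj₁ e₁₂ | inj₁ _ | inj₂ e₃₁ = ⊥-elim (Q₂≢Q₃ (≡ⱼ⇒≡ o₂ o₃ (trans (sym e₁₂) (sym e₃₁))))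

  cycle-closed : ∀ {Q₁ Q₂ Q₃ Q₄} → Cyclic Q₁ Q₂ Q₃ → OneOne S i j Q₁ → OneOne S i j Q₂ →
    OneOne S i j Q₃ → OneOne S i j Q₄ → Q₁ ≢ Q₄ → Q₂ ≢ Q₄ → Q₃ ≢ Q₄ → ⊥
  cycle-closed (e₁₂ , _ , e₃₁) o₁ o₂ o₃ o₄ Q₁≢Q₄ Q₂≢Q₄ Q₃≢Q₄ with linked o₁ o₄ Q₁≢Q₄
  ... | inj₁ e = Q₃≢Q₄ (≡ⱼ⇒≡ o₃ o₄ (trans e₃₁ e))
  ... | inj₂ e = Q₂≢Q₄ (≡ᵢ⇒≡ o₂ o₄ (trans (sym e₁₂) e))

  partE : PartE h S i j
  partE Q₁ Q₂ Q₃ Q₄ o₁ o₂ o₃ o₄ Q₁≢Q₂ Q₁≢Q₃ Q₁≢Q₄ Q₂≢Q₃ Q₂≢Q₄ Q₃≢Q₄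
    with cyclic o₁ o₂ o₃ Q₁≢Q₂ Q₁≢Q₃ Q₂≢Q₃
  ... | inj₁ cyc = cycle-closed cyc o₁ o₂ o₃ o₄ Q₁≢Q₄ Q₂≢Q₄ Q₃≢Q₄
  ... | inj₂ cyc = cycle-closed cyc o₁ o₃ o₂ o₄ Q₁≢Q₄ Q₃≢Q₄ Q₂≢Q₄

  image-tri : ∀ (π : Permutation′ c) (Q : Code c) {a b} → π ⟨$⟩ʳ lookup Q i ≡ a → π ⟨$⟩ʳ lookup Q j ≡ b →
    applyπ π Q ≡ tri i j a b (π ⟨$⟩ʳ lookup Q third)
  image-tri π Q refl refl = trans (cong (applyπ π) (tri-η Q)) (applyπ-tri π _ _ _)

  cycle-image : ∀ {Q₁ Q₂ Q₃} → Cyclic Q₁ Q₂ Q₃ → OneOne S i j Q₁ → OneOne S i j Q₂ → OneOne S i j Q₃ →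
    Q₁ ≢ Q₂ → Q₁ ≢ Q₃ → Q₂ ≢ Q₃ →
    Σ (Permutation′ c) λ π → ∃[ x₁ ] ∃[ x₂ ] ∃[ x₃ ]
      (applyπ π Q₁ ≡ tri i j c₁ c₂ x₁ × applyπ π Q₂ ≡ tri i j c₂ c₃ x₂ × applyπ π Q₃ ≡ tri i j c₃ c₁ x₃)
  cycle-image {Q₁} {Q₂} {Q₃} (e₁₂ , e₂₃ , e₃₁) o₁ o₂ o₃ Q₁≢Q₂ Q₁≢Q₃ Q₂≢Q₃
    with col-distinct h
  ... | c₁≢c₂ , c₁≢c₃ , c₂≢c₃
    with send-three (≢ᵢ o₁ o₂ Q₁≢Q₂) (≢ᵢ o₁ o₃ Q₁≢Q₃) (≢ᵢ o₂ o₃ Q₂≢Q₃) c₁≢c₂ c₁≢c₃ c₂≢c₃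
  ... | π , π₁ , π₂ , π₃ =
    π , _ , _ , _ , image-tri π Q₁ π₁ (trans (cong (π ⟨$⟩ʳ_) e₁₂) π₂)
                  , image-tri π Q₂ π₂ (trans (cong (π ⟨$⟩ʳ_) e₂₃) π₃)
                  , image-tri π Q₃ π₃ (trans (cong (π ⟨$⟩ʳ_) e₃₁) π₁)

  partC : PartC h S i j
  partC Q₁ Q₂ Q₃ o₁ o₂ o₃ Q₁≢Q₂ Q₁≢Q₃ Q₂≢Q₃ with cyclic o₁ o₂ o₃ Q₁≢Q₂ Q₁≢Q₃ Q₂≢Q₃
  ... | inj₁ cyc with cycle-image cyc o₁ o₂ o₃ Q₁≢Q₂ Q₁≢Q₃ Q₂≢Q₃
  ...   | π , _ , _ , _ , e₁ , e₂ , e₃ =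
    π , _ , _ , _ , ↭-reflexive (cong₂ _∷_ e₁ (cong₂ _∷_ e₂ (cong (_∷ []) e₃)))
  partC Q₁ Q₂ Q₃ o₁ o₂ o₃ Q₁≢Q₂ Q₁≢Q₃ Q₂≢Q₃ | inj₂ cyc
    with cycle-image cyc o₁ o₃ o₂ Q₁≢Q₃ Q₁≢Q₂ (≢-sym Q₂≢Q₃)
  ...   | π , _ , _ , _ , e₁ , e₃ , e₂ =
    π , _ , _ , _ , ↭-trans (↭-reflexive (cong₂ _∷_ e₁ (cong₂ _∷_ e₂ (cong (_∷ []) e₃))))
                            (prep _ (swap _ _ ↭-refl))

  chain-image : ∀ {Q₁ Q₂ q₁ q₂} → OneOne S i j Q₁ → OneOne S i j Q₂ → Q₁ ≢ Q₂ →
    ¬ Occurs S i q₁ → ¬ Occurs S j q₂ → lookup Q₁ i ≡ q₂ → lookup Q₂ j ≡ q₁ →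
    Σ (Permutation′ c) λ π → π ⟨$⟩ʳ q₁ ≡ c₃ × π ⟨$⟩ʳ q₂ ≡ c₁ × ∃[ x₁ ] ∃[ x₂ ]
      (applyπ π Q₁ ≡ tri i j c₁ c₂ x₁ × applyπ π Q₂ ≡ tri i j c₂ c₃ x₂)
  chain-image {Q₁} {Q₂} o₁@(Q₁∈S , _) o₂@(Q₂∈S , _) Q₁≢Q₂ q₁∉ q₂∉ e₁ e₂
    with missing-distinct o₁ q₁∉ q₂∉ | linked o₁ o₂ Q₁≢Q₂ | col-distinct h
  ... | q₁≢q₂ | inj₁ e | _ = contradiction (trans (sym e₂) (trans (sym e) e₁)) q₁≢q₂
  ... | q₁≢q₂ | inj₂ e | c₁≢c₂ , c₁≢c₃ , c₂≢c₃
    with send-three (λ q₂≡ → ∈⇒≢ Q₁∈S (trans e₁ (trans q₂≡ (sym e))))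
                    (≢-sym q₁≢q₂)
                    (λ ≡q₁ → ∈⇒≢ Q₂∈S (trans ≡q₁ (sym e₂)))
                    c₁≢c₂ c₁≢c₃ c₂≢c₃
  ... | π , πq₂ , πQ₂i , πq₁ =
    π , πq₁ , πq₂ , _ , _
      , image-tri π Q₁ (trans (cong (π ⟨$⟩ʳ_) e₁) πq₂) (trans (cong (π ⟨$⟩ʳ_) e) πQ₂i)
      , image-tri π Q₂ πQ₂i (trans (cong (π ⟨$⟩ʳ_) e₂) πq₁)

  partG : PartG h S i j
  partG Q₁ Q₂ q₁ q₂ o₁ o₂ Q₁≢Q₂ q₁∉ q₂∉
    with pinned-apart o₁ o₂ Q₁≢Q₂ (pinned o₁ q₁∉ q₂∉) (pinned o₂ q₁∉ q₂∉)
  ... | inj₁ (e₁ , e₂) with chain-image o₁ o₂ Q₁≢Q₂ q₁∉ q₂∉ e₁ e₂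
  ...   | π , πq₁ , πq₂ , x₁ , x₂ , im₁ , im₂ = π , πq₁ , πq₂ , x₁ , x₂ , inj₁ (im₁ , im₂)
  partG Q₁ Q₂ q₁ q₂ o₁ o₂ Q₁≢Q₂ q₁∉ q₂∉ | inj₂ (e₁ , e₂)
    with chain-image o₂ o₁ (≢-sym Q₁≢Q₂) q₁∉ q₂∉ e₂ e₁
  ...   | π , πq₁ , πq₂ , x₁ , x₂ , im₂ , im₁ = π , πq₁ , πq₂ , x₁ , x₂ , inj₂ (im₂ , im₁)

  partsBG : PartsBG h S i j
  partsBG = partB , partC , partD , partE , partF , partG

partA : ∀ {c} (h : 5 ≤ c) (S : List (Code c)) → IsStrategy S → Feasible S → PartA h S
partA h S st fe zero _ _ = Pegs.missing-uniqueᵢ h S st fe pegs01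
partA h S st fe (suc zero) _ _ = Pegs.missing-uniqueⱼ h S st fe pegs01
partA h S st fe (suc (suc zero)) _ _ = Pegs.missing-uniqueⱼ h S st fe pegs02

lemma2 : (c : ℕ) (h : 5 ≤ c) (S : List (Code c)) → IsStrategy S → Feasible S →
    PartA h S × (∀ (i j : Fin 3) → i < j → PartsBG h S i j)
lemma2 c h S st fe = partA h S st fe , λ i j i<j → Pegs.partsBG h S st fe (pegSplit i<j)
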